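{- The chromatic number of the class of signed hexagonal grids is $4$; that is, every signed hexagonal grid $G$ satisfies $\chi_s(G)\le 4$, and some signed hexagonal grid has $\chi_s(G)=4$.
   Context: A signed graph $G=(V,E,s)$ is a finite simple graph (no loops, no parallel edges) with a signature $s:E\to\{ -1,+1\}$ (positive and negative edges). Switching a vertex $v$ reverses the sign of every edge incident to $v$. A homomorphism of signed graphs $G\to H$ is a map $\varphi:V(G)\to V(H)$ such that, after switching some subset of the vertices of $G$, every edge $uv$ of $G$ is mapped to an edge $\varphi(u)\varphi(v)$ of $H$ with the same sign. The chromatic number $\chi_s(G)$ of a signed graph $G$ is the minimum order of a signed graph $H$ such that $G$ admits a homomorphism to $H$; the chromatic number of a class of signed graphs is the maximum of the chromatic numbers of its members. A hexagonal grid is a finite induced subgraph of the (infinite) graph of the tiling of the plane by regular hexagons; a signed hexagonal grid is a hexagonal grid with an arbitrary signature. -}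

module Defs where

open import Data.Nat using (ℕ; _≤_; _%_)
open import Data.Integer using (ℤ; _+_; ∣_∣) renaming (1ℤ to one)
open import Data.Fin using (Fin)
open import Data.Bool using (Bool; _xor_)
open import Data.Product using (Σ; _×_; _,_)
open import Relation.Binary.PropositionalEquality using (_≡_)
open import Relation.Nullary using (¬_)
open import Function.Definitions using (Injective)

-- A (finite) signed graph on the vertex set Fin order.
-- sign u v = true means the edge uv is negative, false means positive.
record SignedGraph : Set₁ where
  field
    order : ℕ
    Adj   : Fin (order) → Fin (order) → Set
    sign  : Fin (order) → Fin (order) → Bool

open SignedGraph public

Simple : SignedGraph → Set
Simple G = (∀ u → ¬ Adj G u u)
         × (∀ u v → Adj G u v → Adj G v u)
         × (∀ u v → Adj G u v → sign G u v ≡ sign G v u)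

-- Signature of G after switching the set of vertices {u | σ u ≡ true}.
switched : (G : SignedGraph) → (Fin (order G) → Bool) → Fin (order G) → Fin (order G) → Bool
switched G σ u v = sign G u v xor (σ u xor σ v)

Hom : SignedGraph → SignedGraph → Set
Hom G H = Σ (Fin (order G) → Fin (order H)) λ φ →
          Σ (Fin (order G) → Bool) λ σ →
          ∀ u v → Adj G u v →
            Adj H (φ u) (φ v) × (switched G σ u v ≡ sign H (φ u) (φ v))

χs≤ : SignedGraph → ℕ → Set₁
χs≤ G k = Σ SignedGraph λ H → Simple H × (order H ≤ k) × Hom G H

χs≥ : SignedGraph → ℕ → Set₁
χs≥ G k = ∀ (H : SignedGraph) → Simple H → Hom G H → k ≤ order H

-- The infinite hexagonal (honeycomb) lattice in brick-wall coordinates: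
-- vertices ℤ × ℤ; (x,y) ~ (x±1,y); and (x,y) ~ (x,y+1) iff x + y is even.
data HexAdj : ℤ × ℤ → ℤ × ℤ → Set where
  right : ∀ x y → HexAdj (x , y) (x + one , y)
  left  : ∀ x y → HexAdj (x + one , y) (x , y)
  up    : ∀ x y → ∣ x + y ∣ % 2 ≡ 0 → HexAdj (x , y) (x , y + one)
  down  : ∀ x y → ∣ x + y ∣ % 2 ≡ 0 → HexAdj (x , y + one) (x , y)

-- A signed hexagonal grid: a finite set of distinct lattice points
-- (the induced subgraph of the lattice on them) with an arbitrary signature.
record SignedHexGrid : Set where
  field
    size     : ℕ
    pos      : Fin size → ℤ × ℤ
    pos-inj  : Injective _≡_ _≡_ pos
    sgn      : Fin size → Fin size → Bool
    sgn-sym  : ∀ u v → sgn u v ≡ sgn v u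

toSigned : SignedHexGrid → SignedGraph
toSigned Γ = record
  { order = SignedHexGrid.size Γ
  ; Adj   = λ u v → HexAdj (SignedHexGrid.pos Γ u) (SignedHexGrid.pos Γ v)
  ; sign  = SignedHexGrid.sgn Γ
  }

-- Let K₄⁻ be K₄ with a single negative edge, and split its colours into the two ends
-- of that edge and the other two.  Embed the grid into the brick-wall lattice on ℕ × ℕ and map the
-- lattice to K₄⁻ row by row, from left to right, choosing a colour and a switching bit per vertex.
-- A vertex whose left and lower neighbours are already mapped has a colour compatible with both
-- edges whenever these neighbours lie in different classes; so a vertex without a lower neighbour
-- takes its colour in the class opposite to the lower neighbour of the vertex after it.  A hexagon with one negative edge is unbalanced.  Every simple signed graph on at
-- most three vertices can be switched to a constant signature, and such a switching pulls back
-- along homomorphisms; but a constant signature on an even cycle is balanced.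

module Submission where

open import Defs
open import Algebra.Bundles using (AbelianGroup)
open import Algebra.Solver.Ring.AlmostCommutativeRing using (fromCommutativeRing)
open import Data.Bool using (Bool; true; false; not; _xor_)
import Data.Bool.Properties as Bool
open import Data.Empty using (⊥-elim)
open import Data.Fin as Fin using (Fin)
open import Data.Fin.Patterns using (0F; 1F; 2F; 3F; 4F; 5F)
open import Data.Fin.Properties using (all?; any?)
open import Data.Integer as ℤ using (ℤ; +_; -[1+_]; ∣_∣; _+_; 1ℤ)
import Data.Integer.Divisibility.Signed as Signed
import Data.Integer.Properties as ℤ
open import Data.Integer.Tactic.RingSolver using (solve-∀)
open import Data.Maybe using (Maybe; just; nothing)
open import Data.Nat as ℕ using (ℕ; zero; suc; _≤_; _%_; _⊔_; _≤?_)
open import Data.Nat.Divisibility using (m%n≡0⇒n∣m; n∣m⇒m%n≡0)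
import Data.Nat.Properties as ℕ
open import Data.Product using (Σ; ∃-syntax; _×_; _,_; proj₁; proj₂)
open import Data.Product.Properties using (≡-dec)
open import Function using (_∘_; _$_)
open import Relation.Binary.PropositionalEquality
open import Relation.Nullary using (¬_; Dec; yes; no; ¬?; _×-dec_; _→-dec_; contradiction)
open import Relation.Nullary.Decidable using (from-yes)

open import Algebra.Properties.Group (AbelianGroup.group ℤ.+-0-abelianGroup) using (∙-cancelʳ)
open import Algebra.Solver.Ring.Simple (fromCommutativeRing Bool.xor-∧-commutativeRing) Bool._≟_
  using (solve; _:=_; _:+_)

Colour : Set
Colour = Fin 4

negative : Colour → Colour → Bool
negative 0F 1F = true
negative 1F 0F = true
negative _  _  = false

onNegativeEdge : Colour → Bool
onNegativeEdge 0F = true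
onNegativeEdge 1F = true
onNegativeEdge _  = false

negative-sym : ∀ a b → negative a b ≡ negative b a
negative-sym = from-yes (all? λ a → all? λ b → negative a b Bool.≟ negative b a)

K₄⁻ : SignedGraph
K₄⁻ = record { order = 4 ; Adj = λ a b → a ≢ b ; sign = negative }

K₄⁻-simple : Simple K₄⁻
K₄⁻-simple = (λ a a≢a → a≢a refl) , (λ a b → ≢-sym) , (λ a b _ → negative-sym a b)

colour-off-class : ∀ a c → ∃[ w ] w ≢ a × onNegativeEdge w ≢ onNegativeEdge c
colour-off-class = from-yes (all? λ a → all? λ c → any? λ w →
  ¬? (w Fin.≟ a) ×-dec ¬? (onNegativeEdge w Bool.≟ onNegativeEdge c))

Between : Bool → Colour → Colour → Colour → Set
Between q a c d = d ≢ a × d ≢ c × negative a d xor negative c d ≡ q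

between? : ∀ q a c d → Dec (Between q a c d)
between? q a c d = ¬? (d Fin.≟ a) ×-dec ¬? (d Fin.≟ c) ×-dec (negative a d xor negative c d Bool.≟ q)

-- Two neighbours in the same class see every third colour with equal signs.
colour-between : ∀ a c q → (q ≡ true → onNegativeEdge a ≢ onNegativeEdge c) → ∃[ d ] Between q a c d
colour-between a c false _ = from-yes (all? λ a → all? λ c → any? (between? false a c)) a c
colour-between a c true  h = from-yes (all? λ a → all? λ c →
  ¬? (onNegativeEdge a Bool.≟ onNegativeEdge c) →-dec any? (between? true a c)) a c (h refl)

State : Set
State = Colour × Bool

colour : State → Colour
colour = proj₁

switch : State → Bool
switch = proj₂

record Fits (s : Bool) (p p' : State) : Set where
  constructor fits
  field
    distinct : colour p ≢ colour p'
    agrees   : s xor (switch p xor switch p') ≡ negative (colour p) (colour p')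

fits-sym : ∀ {s p p'} → Fits s p p' → Fits s p' p
fits-sym {s} {p} {p'} (fits p≢p' agrees) =
  fits (≢-sym p≢p') $ trans (cong (s xor_) (Bool.xor-comm (switch p') (switch p)))
                     (trans agrees (negative-sym (colour p) (colour p')))

switchFor : Bool → State → Colour → Bool
switchFor s p d = (s xor switch p) xor negative (colour p) d

switchFor-fits : ∀ s p {d} → d ≢ colour p → Fits s p (d , switchFor s p d)
switchFor-fits s p {d} d≢p = fits (≢-sym d≢p) $
  solve 3 (λ s x g → s :+ (x :+ ((s :+ x) :+ g)) := g) refl s (switch p) (negative (colour p) d)

switchFor-fits-other : ∀ s p t l {d} → d ≢ colour l →
                       negative (colour p) d xor negative (colour l) d ≡ (s xor switch p) xor (t xor switch l) →
                       Fits t l (d , switchFor s p d)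
switchFor-fits-other s p t l {d} d≢l balanced = fits (≢-sym d≢l) $ begin
  t xor (switch l xor ((s xor switch p) xor g))   ≡⟨ solve 5 (λ t y s x g → t :+ (y :+ ((s :+ x) :+ g))
                                                                       := g :+ ((s :+ x) :+ (t :+ y)))
                                                             refl t (switch l) s (switch p) g ⟩
  g xor ((s xor switch p) xor (t xor switch l))   ≡⟨ cong (g xor_) balanced ⟨
  g xor (g xor h)                                 ≡⟨ solve 2 (λ g h → g :+ (g :+ h) := h) refl g h ⟩
  h                                               ∎
  where
  open ≡-Reasoning
  g = negative (colour p) d
  h = negative (colour l) d

isEven : ℕ → Bool
isEven zero    = true
isEven (suc n) = not (isEven n)

%2≡0⇒isEven : ∀ n → n % 2 ≡ 0 → isEven n ≡ true
%2≡0⇒isEven zero          _  = refl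
%2≡0⇒isEven (suc (suc n)) n% = trans (Bool.not-involutive (isEven n)) (%2≡0⇒isEven n n%)

-- Mapping row t + 1 above the already mapped row t, whose position k is a lower neighbour
-- exactly when k + t is even.
module RowExtension (t : ℕ) (below : ℕ → State) (vertical horizontal : ℕ → Bool) where

  Invariant : Bool → ℕ → State → Set
  Invariant true  k p = Fits (vertical k) (below k) p
  Invariant false k p = onNegativeEdge (colour p) ≢ onNegativeEdge (colour (below (suc k)))

  first : ∀ b → Σ State (Invariant b 0)
  first true  = let d , d≢ , _ = colour-off-class (colour (below 0)) (colour (below 0))
                in  (d , switchFor (vertical 0) (below 0) d) , switchFor-fits (vertical 0) (below 0) d≢
  first false = let w , _ , off = colour-off-class (colour (below 1)) (colour (below 1))
                in  (w , false) , off

  next : ∀ b k p → Invariant b k p →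
         Σ State λ p' → Invariant (not b) (suc k) p' × Fits (horizontal k) p p'
  next true k p _ =
    let w , w≢p , off = colour-off-class (colour p) (colour (below (suc (suc k))))
    in  (w , switchFor (horizontal k) p w) , off , switchFor-fits (horizontal k) p w≢p
  next false k p off =
    let l = below (suc k)
        d , d≢p , d≢l , balanced = colour-between (colour p) (colour l)
          ((horizontal k xor switch p) xor (vertical (suc k) xor switch l)) (λ _ → off)
    in  (d , switchFor (horizontal k) p d) ,
        switchFor-fits-other (horizontal k) p (vertical (suc k)) l d≢l balanced ,
        switchFor-fits (horizontal k) p d≢p

  build : ∀ k → Σ State (Invariant (isEven (k ℕ.+ t)) k)
  build zero    = first (isEven t)
  build (suc k) = proj₁ step , proj₁ (proj₂ step)
    where step = next (isEven (k ℕ.+ t)) k (proj₁ (build k)) (proj₂ (build k))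

RowAbove : ℕ → (ℕ → State) → (ℕ → Bool) → (ℕ → Bool) → Set
RowAbove t below vertical horizontal =
  Σ (ℕ → State) λ row →
    (∀ k → Fits (horizontal k) (row k) (row (suc k))) ×
    (∀ k → isEven (k ℕ.+ t) ≡ true → Fits (vertical k) (below k) (row k))

extendRow : ∀ t below vertical horizontal → RowAbove t below vertical horizontal
extendRow t below vertical horizontal =
  row ,
  (λ k → proj₂ (proj₂ (next (isEven (k ℕ.+ t)) k (row k) (proj₂ (build k))))) ,
  λ k even → subst (λ b → Invariant b k (row k)) even (proj₂ (build k))
  where
  open RowExtension t below vertical horizontal
  row : ℕ → State
  row k = proj₁ (build k)

data LatticeAdj : ℕ × ℕ → ℕ × ℕ → Set where
  right : ∀ k r → LatticeAdj (k , r) (suc k , r)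
  left  : ∀ k r → LatticeAdj (suc k , r) (k , r)
  up    : ∀ k r → isEven (k ℕ.+ r) ≡ true → LatticeAdj (k , r) (k , suc r)
  down  : ∀ k r → isEven (k ℕ.+ r) ≡ true → LatticeAdj (k , suc r) (k , r)

module LatticeColouring (s : ℕ × ℕ → ℕ × ℕ → Bool) where

  horizontalSign verticalSign : ℕ → ℕ → Bool
  horizontalSign r k = s (k , r) (suc k , r)
  verticalSign   r k = s (k , r) (k , suc r)

  -- Row 0 is built above an imaginary row; the constraints towards it are harmless.
  firstRow : RowAbove 0 (λ _ → 0F , false) (λ _ → false) (horizontalSign 0)
  firstRow = extendRow 0 (λ _ → 0F , false) (λ _ → false) (horizontalSign 0)

  rowAbove : ∀ r below → RowAbove r below (verticalSign r) (horizontalSign (suc r))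
  rowAbove r below = extendRow r below (verticalSign r) (horizontalSign (suc r))

  rows : ℕ → ℕ → State
  rows zero    = proj₁ firstRow
  rows (suc r) = proj₁ (rowAbove r (rows r))

  rows-horizontal : ∀ r k → Fits (horizontalSign r k) (rows r k) (rows r (suc k))
  rows-horizontal zero    = proj₁ (proj₂ firstRow)
  rows-horizontal (suc r) = proj₁ (proj₂ (rowAbove r (rows r)))

  rows-vertical : ∀ r k → isEven (k ℕ.+ r) ≡ true →
                  Fits (verticalSign r k) (rows r k) (rows (suc r) k)
  rows-vertical r = proj₂ (proj₂ (rowAbove r (rows r)))

  colouring : ℕ × ℕ → State
  colouring (k , r) = rows r k

  colouring-fits : (∀ P Q → s P Q ≡ s Q P) →
                   ∀ {P Q} → LatticeAdj P Q → Fits (s P Q) (colouring P) (colouring Q)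
  colouring-fits s-sym (right k r)  = rows-horizontal r k
  colouring-fits s-sym (left k r)   = subst (λ σ → Fits σ (rows r (suc k)) (rows r k))
                                            (s-sym (k , r) (suc k , r)) (fits-sym (rows-horizontal r k))
  colouring-fits s-sym (up k r e)   = rows-vertical r k e
  colouring-fits s-sym (down k r e) = subst (λ σ → Fits σ (rows (suc r) k) (rows r k))
                                            (s-sym (k , r) (k , suc r)) (fits-sym (rows-vertical r k e))

lattice-hom : (G : SignedGraph) (cell : Fin (order G) → ℕ × ℕ) (s : ℕ × ℕ → ℕ × ℕ → Bool) →
              (∀ P Q → s P Q ≡ s Q P) →
              (∀ u v → Adj G u v → LatticeAdj (cell u) (cell v)) →
              (∀ u v → s (cell u) (cell v) ≡ sign G u v) →
              Hom G K₄⁻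
lattice-hom G cell s s-sym adj agrees =
  colour ∘ state , switch ∘ state , λ u v uv →
    let fits u≢v matches = colouring-fits s-sym (adj u v uv)
    in  u≢v , trans (cong (_xor _) (sym (agrees u v))) matches
  where
  open LatticeColouring s
  state : Fin (order G) → State
  state = colouring ∘ cell

bounded : ∀ {n} (f : Fin n → ℕ) → ∃[ B ] (∀ i → f i ≤ B)
bounded {zero}  f = 0 , λ ()
bounded {suc n} f with bounded (f ∘ Fin.suc)
... | B , f≤B = f Fin.zero ⊔ B , λ where
  Fin.zero    → ℕ.m≤m⊔n (f Fin.zero) B
  (Fin.suc i) → ℕ.≤-trans (f≤B i) (ℕ.m≤n⊔m (f Fin.zero) B)

shift : ℕ → ℤ → ℕ
shift B z = ∣ z + + B ∣

+shift : ∀ {B} z → ∣ z ∣ ≤ B → + shift B z ≡ z + + B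
+shift (+ n)    _   = refl
+shift -[1+ n ] n<B rewrite ℤ.⊖-≥ n<B = refl

shift-injective : ∀ {B} z z' → ∣ z ∣ ≤ B → ∣ z' ∣ ≤ B → shift B z ≡ shift B z' → z ≡ z'
shift-injective {B} z z' z≤B z'≤B eq =
  ∙-cancelʳ (+ B) z z' (trans (sym (+shift z z≤B)) (trans (cong +_ eq) (+shift z' z'≤B)))

shift-suc : ∀ {B} z → ∣ z ∣ ≤ B → shift B (z + 1ℤ) ≡ suc (shift B z)
shift-suc {B} z z≤B = begin
  ∣ (z + 1ℤ) + + B ∣         ≡⟨ cong ∣_∣ (swap z (+ B)) ⟩
  ∣ (z + + B) + 1ℤ ∣         ≡⟨ cong (λ i → ∣ i + 1ℤ ∣) (+shift z z≤B) ⟨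
  ∣ + shift B z + 1ℤ ∣       ≡⟨ ℕ.+-comm (shift B z) 1 ⟩
  suc (shift B z)            ∎
  where
  open ≡-Reasoning
  swap : ∀ z b → (z + 1ℤ) + b ≡ (z + b) + 1ℤ
  swap = solve-∀

shift-even : ∀ {B} x y → ∣ x ∣ ≤ B → ∣ y ∣ ≤ B → ∣ x + y ∣ % 2 ≡ 0 →
             isEven (shift B x ℕ.+ shift B y) ≡ true
shift-even {B} x y x≤B y≤B x+y%2 = %2≡0⇒isEven k+r (n∣m⇒m%n≡0 k+r 2 (Signed.∣⇒∣ᵤ 2∣k+r))
  where
  k+r : ℕ
  k+r = shift B x ℕ.+ shift B y
  double : ∀ b → b + b ≡ b ℤ.* + 2
  double = solve-∀
  regroup : ∀ x y b → (x + y) + (b + b) ≡ (x + b) + (y + b)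
  regroup = solve-∀
  2∣x+y : + 2 Signed.∣ x + y
  2∣x+y = Signed.∣ᵤ⇒∣ (m%n≡0⇒n∣m ∣ x + y ∣ 2 x+y%2)
  2∣k+r : + 2 Signed.∣ + k+r
  2∣k+r = subst (+ 2 Signed.∣_)
    (trans (regroup x y (+ B)) (sym (cong₂ _+_ (+shift x x≤B) (+shift y y≤B))))
    (Signed.∣m∣n⇒∣m+n 2∣x+y (Signed.divides (+ B) (double (+ B))))

InRange : ℕ → ℤ × ℤ → Set
InRange B (x , y) = ∣ x ∣ ≤ B × ∣ y ∣ ≤ B

toLattice : ℕ → ℤ × ℤ → ℕ × ℕ
toLattice B (x , y) = shift B x , shift B y

toLattice-injective : ∀ {B p q} → InRange B p → InRange B q → toLattice B p ≡ toLattice B q → p ≡ q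
toLattice-injective {p = x , y} {x' , y'} (x≤B , y≤B) (x'≤B , y'≤B) eq =
  cong₂ _,_ (shift-injective x x' x≤B x'≤B (cong proj₁ eq))
            (shift-injective y y' y≤B y'≤B (cong proj₂ eq))

toLattice-adj : ∀ {B p q} → InRange B p → InRange B q → HexAdj p q →
                LatticeAdj (toLattice B p) (toLattice B q)
toLattice-adj (x≤B , _) _ (right x y) rewrite shift-suc x x≤B = right _ _
toLattice-adj _ (x≤B , _) (left x y)  rewrite shift-suc x x≤B = left _ _
toLattice-adj (x≤B , y≤B) _ (up x y even)
  rewrite shift-suc y y≤B = up _ _ (shift-even x y x≤B y≤B even)
toLattice-adj _ (x≤B , y≤B) (down x y even)
  rewrite shift-suc y y≤B = down _ _ (shift-even x y x≤B y≤B even)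

module Grid (Γ : SignedHexGrid) where
  open SignedHexGrid Γ

  bound : ∃[ B ] (∀ u → ∣ proj₁ (pos u) ∣ ⊔ ∣ proj₂ (pos u) ∣ ≤ B)
  bound = bounded λ u → ∣ proj₁ (pos u) ∣ ⊔ ∣ proj₂ (pos u) ∣

  radius : ℕ
  radius = proj₁ bound

  in-range : ∀ u → InRange radius (pos u)
  in-range u = ℕ.≤-trans (ℕ.m≤m⊔n _ _) (proj₂ bound u) , ℕ.≤-trans (ℕ.m≤n⊔m _ _) (proj₂ bound u)

  cell : Fin size → ℕ × ℕ
  cell = toLattice radius ∘ pos

  cell-injective : ∀ {u v} → cell u ≡ cell v → u ≡ v
  cell-injective {u} {v} = pos-inj ∘ toLattice-injective (in-range u) (in-range v)

  locate : ℕ × ℕ → Maybe (Fin size)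
  locate P with any? (λ u → ≡-dec ℕ._≟_ ℕ._≟_ (cell u) P)
  ... | yes (u , _) = just u
  ... | no _        = nothing

  locate-cell : ∀ u → locate (cell u) ≡ just u
  locate-cell u with any? (λ v → ≡-dec ℕ._≟_ ℕ._≟_ (cell v) (cell u))
  ... | yes (v , v≡u) = cong just (cell-injective v≡u)
  ... | no  none      = ⊥-elim (none (u , refl))

  signAt : Maybe (Fin size) → Maybe (Fin size) → Bool
  signAt (just u) (just v) = sgn u v
  signAt _        _        = false

  signAt-sym : ∀ a b → signAt a b ≡ signAt b a
  signAt-sym (just u) (just v) = sgn-sym u v
  signAt-sym (just _) nothing  = refl
  signAt-sym nothing  (just _) = refl
  signAt-sym nothing  nothing  = refl

  hom : Hom (toSigned Γ) K₄⁻
  hom = lattice-hom (toSigned Γ) cell (λ P Q → signAt (locate P) (locate Q))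
          (λ P Q → signAt-sym (locate P) (locate Q))
          (λ u v → toLattice-adj (in-range u) (in-range v))
          (λ u v → cong₂ signAt (locate-cell u) (locate-cell v))

grid-χs≤4 : (Γ : SignedHexGrid) → χs≤ (toSigned Γ) 4
grid-χs≤4 Γ = K₄⁻ , K₄⁻-simple , ℕ.≤-refl , Grid.hom Γ

ConstantUpToSwitching : SignedGraph → Set
ConstantUpToSwitching G =
  Σ (Fin (order G) → Bool) λ w → Σ Bool λ t → ∀ u v → Adj G u v → switched G w u v ≡ t

constantUpToSwitching-pullback : ∀ {G H} → Hom G H → ConstantUpToSwitching H → ConstantUpToSwitching G
constantUpToSwitching-pullback {G} {H} (φ , σ , hom) (w , t , constant) =
  (λ u → σ u xor w (φ u)) , t , λ u v uv → begin
    sign G u v xor ((σ u xor w (φ u)) xor (σ v xor w (φ v)))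
      ≡⟨ solve 5 (λ s a x b y → s :+ ((a :+ x) :+ (b :+ y)) := (s :+ (a :+ b)) :+ (x :+ y))
               refl (sign G u v) (σ u) (w (φ u)) (σ v) (w (φ v)) ⟩
    switched G σ u v xor (w (φ u) xor w (φ v))
      ≡⟨ cong (_xor (w (φ u) xor w (φ v))) (proj₂ (hom u v uv)) ⟩
    switched H w (φ u) (φ v)
      ≡⟨ constant (φ u) (φ v) (proj₁ (hom u v uv)) ⟩
    t ∎
  where open ≡-Reasoning

switched-reverse : ∀ G w → Simple G → ∀ {u v t} → Adj G u v →
                   switched G w v u ≡ t → switched G w u v ≡ t
switched-reverse G w (_ , _ , sign-sym) {u} {v} uv =
  trans (cong₂ _xor_ (sign-sym u v uv) (Bool.xor-comm (w u) (w v)))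

-- On three vertices every edge can be switched to the sign of the triangle.
small-constantUpToSwitching : ∀ H → Simple H → order H ≤ 3 → ConstantUpToSwitching H
small-constantUpToSwitching record { order = 0 } _ _ = (λ ()) , false , λ ()
small-constantUpToSwitching record { order = 1 } (no-loop , _) _ =
  (λ _ → false) , false , λ where 0F 0F loop → ⊥-elim (no-loop 0F loop)
small-constantUpToSwitching H@record { order = 2 ; sign = s } simple@(no-loop , adj-sym , _) _ =
  w , false , constant
  where
  w : Fin 2 → Bool
  w 0F = false
  w 1F = s 0F 1F
  constant : ∀ u v → Adj H u v → switched H w u v ≡ false
  constant 0F 0F loop = ⊥-elim (no-loop 0F loop)
  constant 1F 1F loop = ⊥-elim (no-loop 1F loop)
  constant 0F 1F _    = Bool.xor-same (s 0F 1F)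
  constant 1F 0F uv   = switched-reverse H w simple uv (constant 0F 1F (adj-sym 1F 0F uv))
small-constantUpToSwitching H@record { order = 3 ; sign = s } simple@(no-loop , adj-sym , _) _ =
  w , triangle , constant
  where
  triangle : Bool
  triangle = (s 0F 1F xor s 1F 2F) xor s 0F 2F
  w : Fin 3 → Bool
  w 0F = false
  w 1F = s 0F 1F xor triangle
  w 2F = s 0F 2F xor triangle
  cancel : ∀ a b → a xor (a xor b) ≡ b
  cancel = solve 2 (λ a b → a :+ (a :+ b) := b) refl
  constant : ∀ u v → Adj H u v → switched H w u v ≡ triangle
  constant 0F 1F _ = cancel (s 0F 1F) triangle
  constant 0F 2F _ = cancel (s 0F 2F) triangle
  constant 1F 2F _ = solve 3 (λ x y z → y :+ ((x :+ ((x :+ y) :+ z)) :+ (z :+ ((x :+ y) :+ z)))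
                                         := (x :+ y) :+ z)
                       refl (s 0F 1F) (s 1F 2F) (s 0F 2F)
  constant 1F 0F uv = switched-reverse H w simple uv (constant 0F 1F (adj-sym 1F 0F uv))
  constant 2F 0F uv = switched-reverse H w simple uv (constant 0F 2F (adj-sym 2F 0F uv))
  constant 2F 1F uv = switched-reverse H w simple uv (constant 1F 2F (adj-sym 2F 1F uv))
  constant 0F 0F loop = ⊥-elim (no-loop 0F loop)
  constant 1F 1F loop = ⊥-elim (no-loop 1F loop)
  constant 2F 2F loop = ⊥-elim (no-loop 2F loop)
small-constantUpToSwitching record { order = suc (suc (suc (suc _))) } _ (ℕ.s≤s (ℕ.s≤s (ℕ.s≤s ())))

hexagonPos : Fin 6 → ℤ × ℤ
hexagonPos 0F = + 0 , + 0
hexagonPos 1F = + 1 , + 0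
hexagonPos 2F = + 2 , + 0
hexagonPos 3F = + 2 , + 1
hexagonPos 4F = + 1 , + 1
hexagonPos 5F = + 0 , + 1

hexagonSign : Fin 6 → Fin 6 → Bool
hexagonSign 0F 1F = true
hexagonSign 1F 0F = true
hexagonSign _  _  = false

hexagon : SignedHexGrid
hexagon = record
  { size    = 6
  ; pos     = hexagonPos
  ; pos-inj = λ {u} {v} → from-yes (all? λ u → all? λ v →
                ≡-dec ℤ._≟_ ℤ._≟_ (hexagonPos u) (hexagonPos v) →-dec u Fin.≟ v) u v
  ; sgn     = hexagonSign
  ; sgn-sym = from-yes (all? λ u → all? λ v → hexagonSign u v Bool.≟ hexagonSign v u)
  }

cycleSign : (Fin 6 → Fin 6 → Bool) → Bool
cycleSign s = s 0F 1F xor (s 1F 2F xor (s 2F 3F xor (s 3F 4F xor (s 4F 5F xor s 5F 0F))))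

cycleSign-switching : ∀ s (w : Fin 6 → Bool) → cycleSign (λ u v → s u v xor (w u xor w v)) ≡ cycleSign s
cycleSign-switching s w =
  solve 12 (λ a b c d e f w₀ w₁ w₂ w₃ w₄ w₅ →
      (a :+ (w₀ :+ w₁)) :+ ((b :+ (w₁ :+ w₂)) :+ ((c :+ (w₂ :+ w₃)) :+
        ((d :+ (w₃ :+ w₄)) :+ ((e :+ (w₄ :+ w₅)) :+ (f :+ (w₅ :+ w₀))))))
      := a :+ (b :+ (c :+ (d :+ (e :+ f)))))
    refl (s 0F 1F) (s 1F 2F) (s 2F 3F) (s 3F 4F) (s 4F 5F) (s 5F 0F)
         (w 0F) (w 1F) (w 2F) (w 3F) (w 4F) (w 5F)

cycleSign-constant : ∀ t → cycleSign (λ _ _ → t) ≡ false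
cycleSign-constant false = refl
cycleSign-constant true  = refl

hexagon-not-constant : ¬ ConstantUpToSwitching (toSigned hexagon)
hexagon-not-constant (w , t , constant) = contradiction (begin
  true                                       ≡⟨⟩
  cycleSign hexagonSign                      ≡⟨ cycleSign-switching hexagonSign w ⟨
  cycleSign (switched (toSigned hexagon) w)  ≡⟨ cong₂ _xor_ (constant 0F 1F (right (+ 0) (+ 0)))
                                               (cong₂ _xor_ (constant 1F 2F (right (+ 1) (+ 0)))
                                               (cong₂ _xor_ (constant 2F 3F (up (+ 2) (+ 0) refl))
                                               (cong₂ _xor_ (constant 3F 4F (left (+ 1) (+ 1)))
                                               (cong₂ _xor_ (constant 4F 5F (left (+ 0) (+ 1)))
                                                            (constant 5F 0F (down (+ 0) (+ 0) refl)))))) ⟩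
  cycleSign (λ _ _ → t)                      ≡⟨ cycleSign-constant t ⟩
  false                                      ∎) λ ()
  where open ≡-Reasoning

hexagon-χs≥4 : χs≥ (toSigned hexagon) 4
hexagon-χs≥4 H simple hom with order H ≤? 3
... | yes small = ⊥-elim (hexagon-not-constant (constantUpToSwitching-pullback {toSigned hexagon} {H} hom
                                                   (small-constantUpToSwitching H simple small)))
... | no  large = ℕ.≰⇒> large

theorem2 : ((Γ : SignedHexGrid) → χs≤ (toSigned Γ) 4)
         × (Σ SignedHexGrid λ Γ → χs≤ (toSigned Γ) 4 × χs≥ (toSigned Γ) 4)
theorem2 = grid-χs≤4 , hexagon , grid-χs≤4 hexagon , hexagon-χs≥4
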